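{- We have \[ \liminf_{n,m\to\infty}\frac{\gamma_{2t}(K_n\Box K_m)}{\min\{n,m\}}=\frac32 \qquad\text{and}\qquad \limsup_{n,m\to\infty}\frac{\gamma_{2t}(K_n\Box K_m)}{\min\{n,m\}}=2. \] Furthermore, for every real number $\alpha$ with $\frac32\le\alpha\le 2$ there exists a sequence of pairs of integers $\{(n_k,m_k)\}_{k\ge1}$ such that \[ \lim_{k\to\infty}\frac{\gamma_{2t}(K_{n_k}\Box K_{m_k})}{\min\{n_k,m_k\}}=\alpha. \]
   Context: $K_n$ denotes the complete graph on $n$ vertices. The Cartesian product $G\Box H$ has vertex set $V(G)\times V(H)$, with $(u_1,v_1)\sim(u_2,v_2)$ iff either $u_1=u_2$ and $v_1\sim v_2$, or $v_1=v_2$ and $u_1\sim u_2$. A set $S$ of vertices of a graph $G$ is total $2$-dominating if every vertex of $G$ is adjacent to at least two vertices of $S$; $\gamma_{2t}(G)$ is the minimum cardinality of such a set. -}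

module Defs where

open import Data.Nat using (ℕ; zero; suc; _≤_; _⊓_)
open import Data.Integer using (+_)
open import Data.Rational using (ℚ; _/_; _-_; _+_; ∣_∣; 0ℚ) renaming (_≤_ to _≤ℚ_)
open import Data.Fin using (Fin)
open import Data.Bool using (Bool; T)
open import Data.List using (List; length; filter; cartesianProduct; allFin)
open import Data.Product using (_×_; _,_; proj₁; proj₂; Σ; ∃; ∃-syntax)
open import Data.Sum using (_⊎_)
open import Relation.Nullary using (¬_)
open import Relation.Unary using (Pred)
open import Relation.Binary.PropositionalEquality using (_≡_)
open import Data.Bool.Properties using (T?)

Vertex : ℕ → ℕ → Set
Vertex n m = Fin n × Fin m

Adj : ∀ {n m} → Vertex n m → Vertex n m → Set
Adj (u₁ , v₁) (u₂ , v₂) = (u₁ ≡ u₂ × ¬ (v₁ ≡ v₂)) ⊎ (v₁ ≡ v₂ × ¬ (u₁ ≡ u₂))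

VSet : ℕ → ℕ → Set
VSet n m = Vertex n m → Bool

card : ∀ {n m} → VSet n m → ℕ
card {n} {m} S = length (filter (λ x → T? (S x)) (cartesianProduct (allFin n) (allFin m)))

IsTotal2Dom : ∀ {n m} → VSet n m → Set
IsTotal2Dom {n} {m} S =
  (x : Vertex n m) → ∃[ w₁ ] ∃[ w₂ ] (¬ (w₁ ≡ w₂) × T (S w₁) × T (S w₂) × Adj x w₁ × Adj x w₂)

IsGamma2t : ℕ → ℕ → ℕ → Set
IsGamma2t n m k =
  (∃[ S ] (IsTotal2Dom {n} {m} S × card S ≡ k)) ×
  ((S : VSet n m) → IsTotal2Dom S → k ≤ card S)

-- k / d as a rational (d = 0 never occurs in uses below with d ≥ 1; convention 0)
ratio : ℕ → ℕ → ℚ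
ratio k zero = 0ℚ
ratio k (suc d) = (+ k) / suc d

ρ : ℕ → ℕ → ℕ → ℚ
ρ n m k = ratio k (n ⊓ m)

eps : ℕ → ℚ
eps j = (+ 1) / suc j

LimInfEq : ℚ → Set
LimInfEq c =
  ((j : ℕ) → ∃[ N ] ((n m k : ℕ) → N ≤ n → N ≤ m → IsGamma2t n m k → c - eps j ≤ℚ ρ n m k)) ×
  ((j N : ℕ) → ∃[ n ] ∃[ m ] ∃[ k ] (N ≤ n × N ≤ m × IsGamma2t n m k × ρ n m k ≤ℚ c + eps j))

LimSupEq : ℚ → Set
LimSupEq c =
  ((j : ℕ) → ∃[ N ] ((n m k : ℕ) → N ≤ n → N ≤ m → IsGamma2t n m k → ρ n m k ≤ℚ c + eps j)) ×
  ((j N : ℕ) → ∃[ n ] ∃[ m ] ∃[ k ] (N ≤ n × N ≤ m × IsGamma2t n m k × c - eps j ≤ℚ ρ n m k))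

-- Real numbers à la Bishop: regular Cauchy sequences of rationals
record ℝ : Set where
  field
    seq : ℕ → ℚ
    reg : (i j : ℕ) → ∣ seq i - seq j ∣ ≤ℚ eps i + eps j
open ℝ public

_≤ᵣ_ : ℚ → ℝ → Set
c ≤ᵣ α = (i : ℕ) → c - eps i ≤ℚ seq α i

_ᵣ≤_ : ℝ → ℚ → Set
α ᵣ≤ c = (i : ℕ) → seq α i ≤ℚ c + eps i

ConvergesTo : (ℕ → ℚ) → ℝ → Set
ConvergesTo r α =
  (j : ℕ) → ∃[ K ] ((k : ℕ) → K ≤ k → (i : ℕ) → ∣ r k - seq α i ∣ ≤ℚ eps j + eps i)

-- Total 2-domination in K_n □ K_m is a degree condition: S works iff every cell (u , v) has
-- row(u) + col(v) ≥ 2 + 2·[(u , v) ∈ S].  If a row or column of S is empty, every column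
-- (row) must hold two cells; otherwise double counting the rows against the columns that
-- hold a single cell gives 4|S| ≥ 3(n + m).  Either way γ₂ₜ ≥ (3/2)·min(n, m), while two full
-- columns give γ₂ₜ ≤ 2·min(n, m).  For n = 3a + t, m = 3t + a with a ≤ 3t and t ≤ 3a an
-- explicit set of size 3(a + t) attains the lower bound, and its ratios 3(a + t)/(3a + t)
-- exhaust the rationals in [3/2, 2].  Realising the rational approximations of α, clamped to
-- [3/2, 2], yields a sequence of ratios converging to α.

module Submission where

open import Defs

module Combinatorics where

  open import Data.Bool using (Bool; true; false; T; _∧_; not)
  open import Data.Bool.Properties using (T?; ∧-zeroʳ; ∧-identityʳ)
  open import Data.Empty using (⊥-elim)
  open import Data.Fin as Fin using (Fin; zero; suc; splitAt; quotient)
  open import Data.Fin.Properties using (_≟_; all?; ¬∀⟶∃¬)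
  open import Data.List using (List; length; filter; map; _++_; tabulate; cartesianProduct)
  open import Data.List.Properties using (filter-++; length-++; map-tabulate)
  open import Data.Nat as ℕ using (ℕ; zero; suc; _+_; _*_; _≤_; _<_; _⊓_; _≡ᵇ_; z≤n; s≤s; _<?_)
  open import Data.Nat.Properties hiding (_≟_)
  open import Algebra.Properties.CommutativeSemigroup +-commutativeSemigroup using (x∙yz≈y∙xz)
  open import Algebra.Properties.Semiring.Sum +-*-semiring
    using (sum; sum-syntax; ∑-comm; ∑-distrib-+; sum-cong-≗; *-distribˡ-sum)
  open import Data.Nat.Tactic.RingSolver using (solve-∀)
  open import Data.Product using (_×_; _,_; proj₁; proj₂; ∃; ∃₂; ∃-syntax)
  open import Data.Sum using (_⊎_; inj₁; inj₂; [_,_]′; map₁)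
  open import Function using (_∘_; id; _⇔_; mk⇔; Equivalence)
  open import Relation.Binary.PropositionalEquality
  open import Relation.Nullary using (¬_; Dec; yes; no)
  open import Relation.Nullary.Decidable using (does)

  -- Counting on finite sets

  𝟙 : Bool → ℕ
  𝟙 true  = 1
  𝟙 false = 0

  count : ∀ {n} → (Fin n → Bool) → ℕ
  count {n} P = ∑[ i < n ] 𝟙 (P i)

  ∑-mono-≤ : ∀ {n} {f g : Fin n → ℕ} → (∀ i → f i ≤ g i) → sum f ≤ sum g
  ∑-mono-≤ {zero}  f≤g = z≤n
  ∑-mono-≤ {suc n} f≤g = +-mono-≤ (f≤g zero) (∑-mono-≤ (f≤g ∘ suc))

  ∑-const : ∀ n c → ∑[ i < n ] c ≡ n * c
  ∑-const zero    c = refl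
  ∑-const (suc n) c = cong (c +_) (∑-const n c)

  ∑-splitAt : ∀ k {l} (g : Fin k ⊎ Fin l → ℕ) →
              ∑[ i < k + l ] g (splitAt k i) ≡ sum (g ∘ inj₁) + sum (g ∘ inj₂)
  ∑-splitAt zero    g = refl
  ∑-splitAt (suc k) g = trans (cong (g (inj₁ zero) +_) (∑-splitAt k (g ∘ map₁ suc)))
                              (sym (+-assoc (g (inj₁ zero)) _ _))

  count-false : ∀ n → count {n} (λ _ → false) ≡ 0
  count-false n = trans (∑-const n 0) (*-zeroʳ n)

  count-true : ∀ n → count {n} (λ _ → true) ≡ n
  count-true n = trans (∑-const n 1) (*-identityʳ n)

  count-const : ∀ n b → count {n} (λ _ → b) ≡ n * 𝟙 b
  count-const n b = ∑-const n (𝟙 b)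

  count-singleton : ∀ {n} (q : Fin n) → count (λ e → does (q ≟ e)) ≡ 1
  count-singleton {suc n} zero    = cong suc (count-false n)
  count-singleton {suc n} (suc q) = count-singleton q

  quotient-splitAt : ∀ {t} k (y : Fin (suc t * k)) →
                     quotient {suc t} k y ≡ [ (λ _ → zero) , suc ∘ quotient {t} k ]′ (splitAt k y)
  quotient-splitAt k y with splitAt k y
  ... | inj₁ _ = refl
  ... | inj₂ _ = refl

  count-quotient : ∀ {t} k (d : Fin t) → count (λ y → does (quotient {t} k y ≟ d)) ≡ k
  count-quotient {suc t} k d = begin
    count (λ y → does (quotient {suc t} k y ≟ d))
      ≡⟨ sum-cong-≗ (λ y → cong (λ q → 𝟙 (does (q ≟ d))) (quotient-splitAt k y)) ⟩
    ∑[ y < k + t * k ] g (splitAt k y)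
      ≡⟨ ∑-splitAt k g ⟩
    count {k} (λ _ → does (zero ≟ d)) + count (λ y → does (Fin.suc (quotient {t} k y) ≟ d))
      ≡⟨ blocks d ⟩
    k ∎
    where
    open ≡-Reasoning
    g : Fin k ⊎ Fin (t * k) → ℕ
    g s = 𝟙 (does ([ (λ _ → zero) , suc ∘ quotient {t} k ]′ s ≟ d))
    blocks : ∀ d → count {k} (λ _ → does (zero ≟ d)) + count (λ y → does (Fin.suc (quotient {t} k y) ≟ d)) ≡ k
    blocks zero    = trans (cong₂ _+_ (count-true k) (count-false (t * k))) (+-identityʳ k)
    blocks (suc d) = cong₂ _+_ (count-false k) (count-quotient k d)

  𝟙≤1 : ∀ b → 𝟙 b ≤ 1
  𝟙≤1 true  = ≤-refl
  𝟙≤1 false = z≤n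

  T⇒1≤𝟙 : ∀ {b} → T b → 1 ≤ 𝟙 b
  T⇒1≤𝟙 {true} _ = s≤s z≤n

  𝟙[a∧b]≤𝟙a : ∀ a b → 𝟙 (a ∧ b) ≤ 𝟙 a
  𝟙[a∧b]≤𝟙a true  b = 𝟙≤1 b
  𝟙[a∧b]≤𝟙a false b = z≤n

  count-∧ : ∀ {n} (P : Fin n → Bool) b → count (λ i → P i ∧ b) ≡ count P * 𝟙 b
  count-∧ {n} P true  = trans (sum-cong-≗ (λ i → cong 𝟙 (∧-identityʳ (P i)))) (sym (*-identityʳ (count P)))
  count-∧ {n} P false = trans (sum-cong-≗ (λ i → cong 𝟙 (∧-zeroʳ (P i)))) (trans (count-false n) (sym (*-zeroʳ (count P))))

  _without_ : ∀ {n} → (Fin n → Bool) → Fin n → (Fin n → Bool)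
  (P without i) k = P k ∧ not (does (k ≟ i))

  count-without : ∀ {n} (P : Fin n → Bool) i → count P ≡ 𝟙 (P i) + count (P without i)
  count-without {suc n} P zero = cong (𝟙 (P zero) +_) (sym (cong₂ _+_
    (cong 𝟙 (∧-zeroʳ (P zero))) (sum-cong-≗ (λ k → cong 𝟙 (∧-identityʳ (P (suc k)))))))
  count-without {suc n} P (suc i) = begin
    𝟙 (P zero) + count (P ∘ suc)
      ≡⟨ cong (𝟙 (P zero) +_) (count-without (P ∘ suc) i) ⟩
    𝟙 (P zero) + (𝟙 (P (suc i)) + count ((P ∘ suc) without i))
      ≡⟨ x∙yz≈y∙xz (𝟙 (P zero)) (𝟙 (P (suc i))) _ ⟩
    𝟙 (P (suc i)) + (𝟙 (P zero) + count ((P ∘ suc) without i))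
      ≡⟨ cong (λ b → 𝟙 (P (suc i)) + (𝟙 b + count ((P ∘ suc) without i))) (sym (∧-identityʳ (P zero))) ⟩
    𝟙 (P (suc i)) + count (P without suc i) ∎
    where open ≡-Reasoning

  without-∈ : ∀ {n} (P : Fin n → Bool) {i j} → j ≢ i → T (P j) → T ((P without i) j)
  without-∈ P {i} {j} j≢i p with j ≟ i
  ... | yes j≡i = ⊥-elim (j≢i j≡i)
  ... | no  _   = subst T (sym (∧-identityʳ (P j))) p

  without-∈⁻ : ∀ {n} (P : Fin n → Bool) {i j} → T ((P without i) j) → T (P j) × j ≢ i
  without-∈⁻ P {i} {j} p with j ≟ i
  ... | yes _   = ⊥-elim (subst T (∧-zeroʳ (P j)) p)
  ... | no  j≢i = subst T (∧-identityʳ (P j)) p , j≢i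

  count>0 : ∀ {n} (P : Fin n → Bool) {i} → T (P i) → 0 < count P
  count>0 P {i} p = subst (0 <_) (sym (count-without P i)) (≤-trans (T⇒1≤𝟙 p) (m≤m+n _ _))

  count≥2 : ∀ {n} (P : Fin n → Bool) {i j} → j ≢ i → T (P i) → T (P j) → 2 ≤ count P
  count≥2 P {i} j≢i p q = subst (2 ≤_) (sym (count-without P i))
    (+-mono-≤ (T⇒1≤𝟙 p) (count>0 (P without i) (without-∈ P j≢i q)))

  count>0⇒∃ : ∀ {n} (P : Fin n → Bool) → 0 < count P → ∃ λ i → T (P i)
  count>0⇒∃ {suc n} P pos with P zero in eq
  ... | true  = zero , subst T (sym eq) _
  ... | false = let i , p = count>0⇒∃ (P ∘ suc) pos in suc i , p

  count-without>0 : ∀ {n} (P : Fin n → Bool) i → 2 ≤ count P → 0 < count (P without i)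
  count-without>0 P i two =
    +-cancelˡ-≤ 1 1 _ (≤-trans (subst (2 ≤_) (count-without P i) two) (+-monoˡ-≤ _ (𝟙≤1 (P i))))

  count≥2⇒∃ : ∀ {n} (P : Fin n → Bool) → 2 ≤ count P → ∃₂ λ i j → j ≢ i × T (P i) × T (P j)
  count≥2⇒∃ P two
    with i , p ← count>0⇒∃ P (≤-trans (s≤s z≤n) two)
    with j , q ← count>0⇒∃ (P without i) (count-without>0 P i two)
    = let Pj , j≢i = without-∈⁻ P q in i , j , j≢i , p , Pj

  length-filter-tabulate : ∀ {A : Set} (P : A → Bool) {k} (f : Fin k → A) →
                           length (filter (T? ∘ P) (tabulate f)) ≡ ∑[ i < k ] 𝟙 (P (f i))
  length-filter-tabulate P {zero}  f = refl
  length-filter-tabulate P {suc k} f with P (f zero)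
  ... | true  = cong suc (length-filter-tabulate P (f ∘ suc))
  ... | false = length-filter-tabulate P (f ∘ suc)

  length-filter-cartesianProduct :
    ∀ {A B : Set} (P : A × B → Bool) {k l} (f : Fin k → A) (g : Fin l → B) →
    length (filter (T? ∘ P) (cartesianProduct (tabulate f) (tabulate g))) ≡ ∑[ i < k ] ∑[ j < l ] 𝟙 (P (f i , g j))
  length-filter-cartesianProduct P {zero}  f g = refl
  length-filter-cartesianProduct P {suc k} {l} f g = begin
    length (filter P? (xs ++ ys))                     ≡⟨ cong length (filter-++ P? xs ys) ⟩
    length (filter P? xs ++ filter P? ys)             ≡⟨ length-++ (filter P? xs) ⟩
    length (filter P? xs) + length (filter P? ys)     ≡⟨ cong₂ _+_ first (length-filter-cartesianProduct P (f ∘ suc) g) ⟩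
    ∑[ j < l ] 𝟙 (P (f zero , g j)) + ∑[ i < k ] ∑[ j < l ] 𝟙 (P (f (suc i) , g j)) ∎
    where
    open ≡-Reasoning
    P? : ∀ x → Dec (T (P x))
    P? = T? ∘ P
    xs ys : List (_ × _)
    xs = map (f zero ,_) (tabulate g)
    ys = cartesianProduct (tabulate (f ∘ suc)) (tabulate g)
    first : length (filter P? xs) ≡ ∑[ j < l ] 𝟙 (P (f zero , g j))
    first = trans (cong (length ∘ filter P?) (map-tabulate g (f zero ,_))) (length-filter-tabulate P ((f zero ,_) ∘ g))

  -- The degree condition

  row : ∀ {n m} → VSet n m → Fin n → ℕ
  row S u = count (λ v → S (u , v))

  col : ∀ {n m} → VSet n m → Fin m → ℕ
  col S v = count (λ u → S (u , v))

  transpose : ∀ {n m} → VSet n m → VSet m n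
  transpose S (v , u) = S (u , v)

  card-rows : ∀ {n m} (S : VSet n m) → card S ≡ ∑[ u < n ] row S u
  card-rows S = length-filter-cartesianProduct S id id

  card-transpose : ∀ {n m} (S : VSet n m) → card (transpose S) ≡ card S
  card-transpose S = trans (card-rows (transpose S)) (trans (sym (∑-comm (λ u v → 𝟙 (S (u , v))))) (sym (card-rows S)))

  card-cols : ∀ {n m} (S : VSet n m) → card S ≡ ∑[ v < m ] col S v
  card-cols S = trans (sym (card-transpose S)) (card-rows (transpose S))

  -- row S u + col S v − 2·[(u , v) ∈ S] is the number of neighbours of (u , v) in S.
  DegreeCondition : ∀ {n m} → VSet n m → Set
  DegreeCondition S = ∀ u v → 2 + 2 * 𝟙 (S (u , v)) ≤ row S u + col S v

  degreeCondition-transpose : ∀ {n m} {S : VSet n m} → DegreeCondition S → DegreeCondition (transpose S)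
  degreeCondition-transpose {S = S} deg v u = subst (2 + 2 * 𝟙 (S (u , v)) ≤_) (+-comm (row S u) (col S v)) (deg u v)

  2+2b≤b+R+b+C⇔2≤R+C : ∀ b R C → (2 + 2 * b ≤ (b + R) + (b + C)) ⇔ (2 ≤ R + C)
  2+2b≤b+R+b+C⇔2≤R+C b R C = mk⇔
    (λ h → +-cancelˡ-≤ (2 * b) 2 (R + C) (subst₂ _≤_ (+-comm 2 (2 * b)) (regroup b R C) h))
    (λ h → subst₂ _≤_ (+-comm (2 * b) 2) (sym (regroup b R C)) (+-monoʳ-≤ (2 * b) h))
    where
    regroup : ∀ b R C → (b + R) + (b + C) ≡ 2 * b + (R + C)
    regroup = solve-∀

  2≤+-cases : ∀ R C → 2 ≤ R + C → 2 ≤ R ⊎ 2 ≤ C ⊎ (0 < R × 0 < C)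
  2≤+-cases zero          C       h       = inj₂ (inj₁ h)
  2≤+-cases (suc zero)    zero    (s≤s ())
  2≤+-cases (suc zero)    (suc C) _       = inj₂ (inj₂ (s≤s z≤n , s≤s z≤n))
  2≤+-cases (suc (suc R)) C       _       = inj₁ (s≤s (s≤s z≤n))

  module _ {n m} (S : VSet n m) where

    rowNeighbours : Fin n → Fin m → Fin m → Bool
    rowNeighbours u v = (λ w → S (u , w)) without v

    colNeighbours : Fin n → Fin m → Fin n → Bool
    colNeighbours u v = (λ w → S (w , v)) without u

    degree⇔neighbours : ∀ u v → (2 + 2 * 𝟙 (S (u , v)) ≤ row S u + col S v) ⇔
                                (2 ≤ count (rowNeighbours u v) + count (colNeighbours u v))
    degree⇔neighbours u v =
      subst₂ (λ R C → (2 + 2 * 𝟙 (S (u , v)) ≤ R + C) ⇔ (2 ≤ count (rowNeighbours u v) + count (colNeighbours u v)))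
        (sym (count-without (λ w → S (u , w)) v)) (sym (count-without (λ w → S (w , v)) u))
        (2+2b≤b+R+b+C⇔2≤R+C (𝟙 (S (u , v))) _ _)

    rowNeighbour : ∀ {u v w} → T (rowNeighbours u v w) → T (S (u , w)) × Adj (u , v) (u , w)
    rowNeighbour {u} p = let s , w≢v = without-∈⁻ (λ w → S (u , w)) p in s , inj₁ (refl , ≢-sym w≢v)

    colNeighbour : ∀ {u v w} → T (colNeighbours u v w) → T (S (w , v)) × Adj (u , v) (w , v)
    colNeighbour {v = v} p = let s , w≢u = without-∈⁻ (λ w → S (w , v)) p in s , inj₂ (refl , ≢-sym w≢u)

    neighbours⇒total2Dom : (∀ u v → 2 ≤ count (rowNeighbours u v) + count (colNeighbours u v)) →
                           IsTotal2Dom S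
    neighbours⇒total2Dom h (u , v) with 2≤+-cases _ _ (h u v)
    ... | inj₁ two =
      let i , j , j≢i , p , q = count≥2⇒∃ (rowNeighbours u v) two
          Si , ai = rowNeighbour p
          Sj , aj = rowNeighbour q
      in (u , i) , (u , j) , (λ e → j≢i (sym (cong proj₂ e))) , Si , Sj , ai , aj
    ... | inj₂ (inj₁ two) =
      let i , j , j≢i , p , q = count≥2⇒∃ (colNeighbours u v) two
          Si , ai = colNeighbour p
          Sj , aj = colNeighbour q
      in (i , v) , (j , v) , (λ e → j≢i (sym (cong proj₁ e))) , Si , Sj , ai , aj
    ... | inj₂ (inj₂ (r , c)) =
      let i , p = count>0⇒∃ (rowNeighbours u v) r
          j , q = count>0⇒∃ (colNeighbours u v) c
          Si , ai = rowNeighbour p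
          Sj , aj = colNeighbour q
      in (u , i) , (j , v) , (λ e → proj₂ (without-∈⁻ (λ w → S (w , v)) q) (sym (cong proj₁ e))) , Si , Sj , ai , aj

    private
      RowOrColNeighbour : Fin n → Fin m → Vertex n m → Set
      RowOrColNeighbour u v w = (∃ λ v′ → w ≡ (u , v′) × T (rowNeighbours u v v′)) ⊎
                                (∃ λ u′ → w ≡ (u′ , v) × T (colNeighbours u v u′))

      rowOrColNeighbour : ∀ {u v w} → T (S w) → Adj (u , v) w → RowOrColNeighbour u v w
      rowOrColNeighbour {u} {v} s (inj₁ (refl , v≢v′)) = inj₁ (_ , refl , without-∈ (λ w → S (u , w)) (≢-sym v≢v′) s)
      rowOrColNeighbour {u} {v} s (inj₂ (refl , u≢u′)) = inj₂ (_ , refl , without-∈ (λ w → S (w , v)) (≢-sym u≢u′) s)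

      two-neighbours : ∀ {u v w₁ w₂} → w₁ ≢ w₂ → RowOrColNeighbour u v w₁ → RowOrColNeighbour u v w₂ →
                       2 ≤ count (rowNeighbours u v) + count (colNeighbours u v)
      two-neighbours {u} {v} w₁≢w₂ (inj₁ (_ , refl , p)) (inj₁ (_ , refl , q)) =
        ≤-trans (count≥2 (rowNeighbours u v) (λ e → w₁≢w₂ (cong (_ ,_) (sym e))) p q) (m≤m+n _ _)
      two-neighbours {u} {v} _ (inj₁ (_ , refl , p)) (inj₂ (_ , refl , q)) =
        +-mono-≤ (count>0 (rowNeighbours u v) p) (count>0 (colNeighbours u v) q)
      two-neighbours {u} {v} _ (inj₂ (_ , refl , p)) (inj₁ (_ , refl , q)) =
        +-mono-≤ (count>0 (rowNeighbours u v) q) (count>0 (colNeighbours u v) p)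
      two-neighbours {u} {v} w₁≢w₂ (inj₂ (_ , refl , p)) (inj₂ (_ , refl , q)) =
        ≤-trans (count≥2 (colNeighbours u v) (λ e → w₁≢w₂ (cong (_, _) (sym e))) p q) (m≤n+m _ _)

    total2Dom⇒neighbours : IsTotal2Dom S →
                           ∀ u v → 2 ≤ count (rowNeighbours u v) + count (colNeighbours u v)
    total2Dom⇒neighbours dom u v =
      let w₁ , w₂ , w₁≢w₂ , s₁ , s₂ , a₁ , a₂ = dom (u , v)
      in two-neighbours w₁≢w₂ (rowOrColNeighbour s₁ a₁) (rowOrColNeighbour s₂ a₂)

    degreeCondition⇒total2Dom : DegreeCondition S → IsTotal2Dom S
    degreeCondition⇒total2Dom deg = neighbours⇒total2Dom λ u v → Equivalence.to (degree⇔neighbours u v) (deg u v)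

    total2Dom⇒degreeCondition : IsTotal2Dom S → DegreeCondition S
    total2Dom⇒degreeCondition dom u v = Equivalence.from (degree⇔neighbours u v) (total2Dom⇒neighbours dom u v)

  -- Lower bound

  singletonRows : ∀ {n m} → VSet n m → ℕ
  singletonRows S = count (λ u → row S u ≡ᵇ 1)

  singletonCols : ∀ {n m} → VSet n m → ℕ
  singletonCols S = count (λ v → col S v ≡ᵇ 1)

  row-inequality : ∀ r x → 0 < r → x ≤ r → (r ≤ 2 → x ≤ 0) → 3 + x ≤ 2 * r + 𝟙 (r ≡ᵇ 1)
  row-inequality 1 x _ _ small = +-monoʳ-≤ 3 (small (s≤s z≤n))
  row-inequality 2 x _ _ small = ≤-trans (+-monoʳ-≤ 3 (small ≤-refl)) (n≤1+n 3)
  row-inequality r@(suc (suc (suc k))) x _ x≤r _ =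
    ≤-trans (+-monoʳ-≤ 3 x≤r) (≤-trans (+-monoˡ-≤ r (s≤s (s≤s (s≤s z≤n)))) (≤-reflexive (double r)))
    where
    double : ∀ r → r + r ≡ 2 * r + 0
    double = solve-∀

  module _ {n m} {S : VSet n m} (deg : DegreeCondition S) where

    emptyRow⇒card : ∀ u → ¬ 0 < row S u → 2 * m ≤ card S
    emptyRow⇒card u empty = begin
      2 * m              ≡⟨ trans (*-comm 2 m) (sym (∑-const m 2)) ⟩
      ∑[ v < m ] 2       ≤⟨ ∑-mono-≤ 2≤col ⟩
      ∑[ v < m ] col S v ≡⟨ card-cols S ⟨
      card S             ∎
      where
      open ≤-Reasoning
      2≤col : ∀ v → 2 ≤ col S v
      2≤col v = ≤-trans (m≤m+n 2 _) (≤-trans (deg u v) (+-monoˡ-≤ (col S v) (≮⇒≥ empty)))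

    private
      single : Fin m → Bool
      single v = col S v ≡ᵇ 1

      singletonColCells : Fin n → ℕ
      singletonColCells u = count (λ v → S (u , v) ∧ single v)

      singletonColCells≤row : ∀ u → singletonColCells u ≤ row S u
      singletonColCells≤row u = ∑-mono-≤ (λ v → 𝟙[a∧b]≤𝟙a (S (u , v)) _)

      -- A cell alone in its column has all its S-neighbours in its row.
      singletonColCells-smallRow : ∀ u → row S u ≤ 2 → singletonColCells u ≤ 0
      singletonColCells-smallRow u small = ≤-trans (∑-mono-≤ cell) (≤-reflexive (count-false m))
        where
        cell : ∀ v → 𝟙 (S (u , v) ∧ single v) ≤ 0
        cell v with S (u , v) in s | col S v ≡ᵇ 1 in c
        ... | false | _     = z≤n
        ... | true  | false = z≤n
        ... | true  | true  = ⊥-elim (<⇒≱ (s≤s (+-mono-≤ small (≤-reflexive col≡1))) four≤)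
          where
          col≡1 : col S v ≡ 1
          col≡1 = ≡ᵇ⇒≡ (col S v) 1 (subst T (sym c) _)
          four≤ : 4 ≤ row S u + col S v
          four≤ = subst (λ b → 2 + 2 * 𝟙 b ≤ row S u + col S v) s (deg u v)

      ∑singletonColCells : ∑[ u < n ] singletonColCells u ≡ singletonCols S
      ∑singletonColCells = begin
        ∑[ u < n ] ∑[ v < m ] 𝟙 (S (u , v) ∧ single v)
          ≡⟨ ∑-comm (λ u v → 𝟙 (S (u , v) ∧ single v)) ⟩
        ∑[ v < m ] count (λ u → S (u , v) ∧ single v)
          ≡⟨ sum-cong-≗ (λ v → count-∧ (λ u → S (u , v)) (single v)) ⟩
        ∑[ v < m ] (col S v * 𝟙 (single v))
          ≡⟨ sum-cong-≗ (λ v → c*𝟙[c≡1]≡𝟙[c≡1] (col S v)) ⟩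
        singletonCols S ∎
        where
        open ≡-Reasoning
        c*𝟙[c≡1]≡𝟙[c≡1] : ∀ c → c * 𝟙 (c ≡ᵇ 1) ≡ 𝟙 (c ≡ᵇ 1)
        c*𝟙[c≡1]≡𝟙[c≡1] 0             = refl
        c*𝟙[c≡1]≡𝟙[c≡1] 1             = refl
        c*𝟙[c≡1]≡𝟙[c≡1] (suc (suc c)) = *-zeroʳ (suc (suc c))

    nonemptyRows⇒card : (∀ u → 0 < row S u) → 3 * n + singletonCols S ≤ 2 * card S + singletonRows S
    nonemptyRows⇒card nonempty = begin
      3 * n + singletonCols S
        ≡⟨ cong₂ _+_ (trans (*-comm 3 n) (sym (∑-const n 3))) (sym ∑singletonColCells) ⟩
      ∑[ u < n ] 3 + ∑[ u < n ] singletonColCells u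
        ≡⟨ ∑-distrib-+ (λ _ → 3) singletonColCells ⟨
      ∑[ u < n ] (3 + singletonColCells u)
        ≤⟨ ∑-mono-≤ perRow ⟩
      ∑[ u < n ] (2 * row S u + 𝟙 (row S u ≡ᵇ 1))
        ≡⟨ ∑-distrib-+ (λ u → 2 * row S u) (λ u → 𝟙 (row S u ≡ᵇ 1)) ⟩
      ∑[ u < n ] (2 * row S u) + singletonRows S
        ≡⟨ cong (_+ singletonRows S) (trans (cong (2 *_) (card-rows S)) (*-distribˡ-sum 2 (row S))) ⟨
      2 * card S + singletonRows S ∎
      where
      open ≤-Reasoning
      perRow : ∀ u → 3 + singletonColCells u ≤ 2 * row S u + 𝟙 (row S u ≡ᵇ 1)
      perRow u = row-inequality (row S u) (singletonColCells u) (nonempty u)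
                   (singletonColCells≤row u) (singletonColCells-smallRow u)

  add-row-and-col-bounds : ∀ n m p q c → 3 * n + p ≤ 2 * c + q → 3 * m + q ≤ 2 * c + p → 3 * (n + m) ≤ 4 * c
  add-row-and-col-bounds n m p q c h₁ h₂ =
    +-cancelʳ-≤ (p + q) _ _ (subst₂ _≤_ (lhs n m p q) (rhs c p q) (+-mono-≤ h₁ h₂))
    where
    lhs : ∀ n m p q → 3 * n + p + (3 * m + q) ≡ 3 * (n + m) + (p + q)
    lhs = solve-∀
    rhs : ∀ c p q → 2 * c + q + (2 * c + p) ≡ 4 * c + (p + q)
    rhs = solve-∀

  degreeCondition⇒card : ∀ {n m} {S : VSet n m} → DegreeCondition S →
                         2 * m ≤ card S ⊎ 2 * n ≤ card S ⊎ 3 * (n + m) ≤ 4 * card S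
  degreeCondition⇒card {n} {m} {S} deg
    with all? (λ u → 0 <? row S u) | all? (λ v → 0 <? col S v)
  ... | no ¬rows | _ =
    inj₁ (emptyRow⇒card deg _ (proj₂ (¬∀⟶∃¬ n _ (λ u → 0 <? row S u) ¬rows)))
  ... | yes _ | no ¬cols =
    inj₂ (inj₁ (subst (2 * n ≤_) (card-transpose S)
      (emptyRow⇒card (degreeCondition-transpose deg) _ (proj₂ (¬∀⟶∃¬ m _ (λ v → 0 <? col S v) ¬cols)))))
  ... | yes rows | yes cols =
    inj₂ (inj₂ (add-row-and-col-bounds n m (singletonCols S) (singletonRows S) (card S)
      (nonemptyRows⇒card deg rows)
      (subst (λ c → 3 * m + singletonRows S ≤ 2 * c + singletonCols S) (card-transpose S)
        (nonemptyRows⇒card (degreeCondition-transpose deg) cols))))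

  3x≤2[2y] : ∀ {x y} → x ≤ y → 3 * x ≤ 2 * (2 * y)
  3x≤2[2y] {x} {y} x≤y = ≤-trans (*-monoʳ-≤ 3 x≤y) (≤-trans (*-monoˡ-≤ y (n≤1+n 3)) (≤-reflexive (*-assoc 2 2 y)))

  total2Dom⇒3min≤2card : ∀ {n m} {S : VSet n m} → IsTotal2Dom S → 3 * (n ⊓ m) ≤ 2 * card S
  total2Dom⇒3min≤2card {n} {m} {S} dom with degreeCondition⇒card (total2Dom⇒degreeCondition S dom)
  ... | inj₁ 2m≤c        = ≤-trans (3x≤2[2y] (m⊓n≤n n m)) (*-monoʳ-≤ 2 2m≤c)
  ... | inj₂ (inj₁ 2n≤c) = ≤-trans (3x≤2[2y] (m⊓n≤m n m)) (*-monoʳ-≤ 2 2n≤c)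
  ... | inj₂ (inj₂ h)    = *-cancelˡ-≤ 2 (begin
    2 * (3 * (n ⊓ m))           ≡⟨ 2[3x]≡3x+3x (n ⊓ m) ⟩
    3 * (n ⊓ m) + 3 * (n ⊓ m)   ≤⟨ +-mono-≤ (*-monoʳ-≤ 3 (m⊓n≤m n m)) (*-monoʳ-≤ 3 (m⊓n≤n n m)) ⟩
    3 * n + 3 * m               ≡⟨ *-distribˡ-+ 3 n m ⟨
    3 * (n + m)                 ≤⟨ h ⟩
    4 * card S                  ≡⟨ *-assoc 2 2 (card S) ⟩
    2 * (2 * card S)            ∎)
    where
    open ≤-Reasoning
    2[3x]≡3x+3x : ∀ x → 2 * (3 * x) ≡ 3 * x + 3 * x
    2[3x]≡3x+3x = solve-∀

  -- Upper bound

  firstTwo : ∀ {m} → Fin m → Bool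
  firstTwo zero          = true
  firstTwo (suc zero)    = true
  firstTwo (suc (suc _)) = false

  twoColumns : ∀ n m → VSet n m
  twoColumns n m (_ , v) = firstTwo v

  row-twoColumns : ∀ {n} m u → row (twoColumns n (2 + m)) u ≡ 2
  row-twoColumns m u = cong (2 +_) (count-false m)

  twoColumns-degree : ∀ {n} m → 2 ≤ n → DegreeCondition (twoColumns n (2 + m))
  twoColumns-degree {n} m 2≤n u v = subst (λ r → 2 + 2 * 𝟙 (firstTwo v) ≤ r + col (twoColumns n (2 + m)) v)
    (sym (row-twoColumns m u)) (+-monoʳ-≤ 2 (subst (2 * 𝟙 (firstTwo v) ≤_) (sym (count-const n (firstTwo v)))
      (*-monoˡ-≤ (𝟙 (firstTwo v)) 2≤n)))

  card-twoColumns : ∀ n m → card (twoColumns n (2 + m)) ≡ n * 2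
  card-twoColumns n m = trans (card-rows (twoColumns n (2 + m))) (trans (sum-cong-≗ (row-twoColumns {n} m)) (∑-const n 2))

  gamma2t≤2min : ∀ {n m γ} → 2 ≤ n → 2 ≤ m → IsGamma2t n m γ → γ ≤ 2 * (n ⊓ m)
  gamma2t≤2min {suc zero} (s≤s ()) _ _
  gamma2t≤2min {suc (suc _)} {suc zero} _ (s≤s ()) _
  gamma2t≤2min {n@(suc (suc n′))} {m@(suc (suc m′))} {γ} 2≤n 2≤m (_ , minimal) =
    subst (γ ≤_) (sym (*-distribˡ-⊓ 2 n m)) (⊓-glb γ≤2n γ≤2m)
    where
    columns : VSet n m
    columns = twoColumns n m
    rows : VSet n m
    rows = transpose (twoColumns m n)
    γ≤2n : γ ≤ 2 * n
    γ≤2n = subst (γ ≤_) (trans (card-twoColumns n m′) (*-comm n 2))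
      (minimal columns (degreeCondition⇒total2Dom columns (twoColumns-degree m′ 2≤n)))
    γ≤2m : γ ≤ 2 * m
    γ≤2m = subst (γ ≤_) (trans (card-transpose (twoColumns m n)) (trans (card-twoColumns m n′) (*-comm m 2)))
      (minimal rows (degreeCondition⇒total2Dom rows (degreeCondition-transpose {S = twoColumns m n} (twoColumns-degree n′ 2≤m))))

  -- The extremal family

  -- Each of the first a·3 rows holds one cell, in the last a columns, three rows per column;
  -- symmetrically each of the last t rows holds three cells, covering each of the first t·3
  -- columns once.
  block : ∀ {a t} → Fin (a * 3) ⊎ Fin t → Fin (t * 3) ⊎ Fin a → Bool
  block {a}     (inj₁ x) (inj₂ e) = does (quotient {a} 3 x ≟ e)
  block {t = t} (inj₂ d) (inj₁ y) = does (quotient {t} 3 y ≟ d)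
  block         _        _        = false

  family : ∀ a t → VSet (a * 3 + t) (t * 3 + a)
  family a t (u , v) = block (splitAt (a * 3) u) (splitAt (t * 3) v)

  block-comm : ∀ {a t} x y → block {a} {t} x y ≡ block {t} {a} y x
  block-comm (inj₁ _) (inj₁ _) = refl
  block-comm (inj₁ _) (inj₂ _) = refl
  block-comm (inj₂ _) (inj₁ _) = refl
  block-comm (inj₂ _) (inj₂ _) = refl

  lineSize : ∀ {k l} → Fin k ⊎ Fin l → ℕ
  lineSize (inj₁ _) = 1
  lineSize (inj₂ _) = 3

  count-block : ∀ {a t} x → count (λ v → block {a} {t} x (splitAt (t * 3) v)) ≡ lineSize x
  count-block {a} {t} x = trans (∑-splitAt (t * 3) (𝟙 ∘ block x)) (lines x)
    where
    lines : ∀ x → count (block {a} {t} x ∘ inj₁) + count (block {a} {t} x ∘ inj₂) ≡ lineSize x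
    lines (inj₁ x) = cong₂ _+_ (count-false (t * 3)) (count-singleton (quotient {a} 3 x))
    lines (inj₂ d) = trans (cong₂ _+_ (count-quotient 3 d) (count-false a)) (+-identityʳ 3)

  row-family : ∀ a t u → row (family a t) u ≡ lineSize (splitAt (a * 3) u)
  row-family a t u = count-block (splitAt (a * 3) u)

  col-family : ∀ a t v → col (family a t) v ≡ lineSize (splitAt (t * 3) v)
  col-family a t v = trans (sum-cong-≗ (λ u → cong 𝟙 (block-comm (splitAt (a * 3) u) (splitAt (t * 3) v))))
                           (row-family t a v)

  2+2b≤4 : ∀ b → 2 + 2 * 𝟙 b ≤ 4
  2+2b≤4 true  = ≤-refl
  2+2b≤4 false = s≤s (s≤s z≤n)

  block-degree : ∀ {a t} x y → 2 + 2 * 𝟙 (block {a} {t} x y) ≤ lineSize x + lineSize y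
  block-degree (inj₁ _) (inj₁ _) = ≤-refl
  block-degree {a} {t} (inj₁ x) (inj₂ e) = 2+2b≤4 (block {a} {t} (inj₁ x) (inj₂ e))
  block-degree {a} {t} (inj₂ d) (inj₁ y) = 2+2b≤4 (block {a} {t} (inj₂ d) (inj₁ y))
  block-degree (inj₂ _) (inj₂ _) = s≤s (s≤s z≤n)

  family-degree : ∀ a t → DegreeCondition (family a t)
  family-degree a t u v = subst₂ (λ r c → 2 + 2 * 𝟙 (family a t (u , v)) ≤ r + c)
    (sym (row-family a t u)) (sym (col-family a t v)) (block-degree (splitAt (a * 3) u) (splitAt (t * 3) v))

  card-family : ∀ a t → card (family a t) ≡ a * 3 + t * 3
  card-family a t = begin
    card (family a t)                                ≡⟨ card-rows (family a t) ⟩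
    ∑[ u < a * 3 + t ] row (family a t) u            ≡⟨ sum-cong-≗ (row-family a t) ⟩
    ∑[ u < a * 3 + t ] lineSize (splitAt (a * 3) u)  ≡⟨ ∑-splitAt (a * 3) lineSize ⟩
    ∑[ u < a * 3 ] 1 + ∑[ d < t ] 3                  ≡⟨ cong₂ _+_ (trans (∑-const (a * 3) 1) (*-identityʳ (a * 3)))
                                                                  (∑-const t 3) ⟩
    a * 3 + t * 3                                    ∎
    where open ≡-Reasoning

  a*3+t*3≤2[t*3+a] : ∀ {a t} → a ≤ t * 3 → a * 3 + t * 3 ≤ 2 * (t * 3 + a)
  a*3+t*3≤2[t*3+a] {a} {t} a≤3t = subst₂ _≤_ (sym (lhs a t)) (sym (rhs a t)) (+-monoʳ-≤ (t * 3 + 2 * a) a≤3t)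
    where
    lhs : ∀ a t → a * 3 + t * 3 ≡ t * 3 + 2 * a + a
    lhs = solve-∀
    rhs : ∀ a t → 2 * (t * 3 + a) ≡ t * 3 + 2 * a + t * 3
    rhs = solve-∀

  family-isGamma2t : ∀ a t → a ≤ t * 3 → t ≤ a * 3 → IsGamma2t (a * 3 + t) (t * 3 + a) (a * 3 + t * 3)
  family-isGamma2t a t a≤3t t≤3a =
    (family a t , degreeCondition⇒total2Dom (family a t) (family-degree a t) , card-family a t) ,
    λ S dom → lowerBound (degreeCondition⇒card (total2Dom⇒degreeCondition S dom))
    where
    lowerBound : ∀ {c} → 2 * (t * 3 + a) ≤ c ⊎ 2 * (a * 3 + t) ≤ c ⊎ 3 * (a * 3 + t + (t * 3 + a)) ≤ 4 * c →
                 a * 3 + t * 3 ≤ c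
    lowerBound (inj₁ h)        = ≤-trans (a*3+t*3≤2[t*3+a] {a} {t} a≤3t) h
    lowerBound (inj₂ (inj₁ h)) = ≤-trans (≤-reflexive (+-comm (a * 3) (t * 3))) (≤-trans (a*3+t*3≤2[t*3+a] {t} {a} t≤3a) h)
    lowerBound {c} (inj₂ (inj₂ h)) = *-cancelˡ-≤ 4 (subst (_≤ 4 * c) (sizes a t) h)
      where
      sizes : ∀ a t → 3 * (a * 3 + t + (t * 3 + a)) ≡ 4 * (a * 3 + t * 3)
      sizes = solve-∀

  -- y = 2q − p and z = 2p − 3q.
  fraction-decomposition : ∀ p q → 3 * q ≤ p * 2 → p ≤ 2 * q →
                           ∃₂ λ y z → p ≡ 3 * y + 2 * z × q ≡ 2 * y + z
  fraction-decomposition p q 3q≤2p p≤2q = y , z , p≡ , q≡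
    where
    y z : ℕ
    y = proj₁ (m≤n⇒∃[o]m+o≡n p≤2q)
    z = proj₁ (m≤n⇒∃[o]m+o≡n 3q≤2p)
    p+y≡2q : p + y ≡ 2 * q
    p+y≡2q = proj₂ (m≤n⇒∃[o]m+o≡n p≤2q)
    3q+z≡2p : 3 * q + z ≡ p * 2
    3q+z≡2p = proj₂ (m≤n⇒∃[o]m+o≡n 3q≤2p)
    open ≡-Reasoning
    p≡ : p ≡ 3 * y + 2 * z
    p≡ = +-cancelʳ-≡ (3 * p + 6 * q) p (3 * y + 2 * z) (begin
      p + (3 * p + 6 * q)              ≡⟨ e₁ p q ⟩
      3 * (2 * q) + 2 * (p * 2)        ≡⟨ cong₂ (λ u v → 3 * u + 2 * v) p+y≡2q 3q+z≡2p ⟨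
      3 * (p + y) + 2 * (3 * q + z)    ≡⟨ e₂ p q y z ⟩
      3 * y + 2 * z + (3 * p + 6 * q)  ∎)
      where
      e₁ : ∀ p q → p + (3 * p + 6 * q) ≡ 3 * (2 * q) + 2 * (p * 2)
      e₁ = solve-∀
      e₂ : ∀ p q y z → 3 * (p + y) + 2 * (3 * q + z) ≡ 3 * y + 2 * z + (3 * p + 6 * q)
      e₂ = solve-∀
    q≡ : q ≡ 2 * y + z
    q≡ = +-cancelʳ-≡ (2 * p + 3 * q) q (2 * y + z) (begin
      q + (2 * p + 3 * q)              ≡⟨ e₁ p q ⟩
      2 * (2 * q) + p * 2              ≡⟨ cong₂ (λ u v → 2 * u + v) p+y≡2q 3q+z≡2p ⟨
      2 * (p + y) + (3 * q + z)        ≡⟨ e₂ p q y z ⟩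
      2 * y + z + (2 * p + 3 * q)      ∎)
      where
      e₁ : ∀ p q → q + (2 * p + 3 * q) ≡ 2 * (2 * q) + p * 2
      e₁ = solve-∀
      e₂ : ∀ p q y z → 2 * (p + y) + (3 * q + z) ≡ 2 * y + z + (2 * p + 3 * q)
      e₂ = solve-∀

  -- a = (3y + z)s and t = 3(y + z)s solve 3(a + t)/(3a + t) = (3y + 2z)/(2y + z); the
  -- factor s = 1 + N makes the graph large.
  family-attains : ∀ y z N → 0 < 2 * y + z →
    ∃[ n ] ∃[ m ] ∃[ γ ] (N < n × N < m × IsGamma2t n m γ × 0 < n ⊓ m ×
                          γ * (2 * y + z) ≡ (3 * y + 2 * z) * (n ⊓ m))
  family-attains y z N q>0 =
    a * 3 + t , t * 3 + a , a * 3 + t * 3 , N<n , ≤-trans N<n n≤m ,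
    family-isGamma2t a t a≤3t t≤3a , subst (0 <_) (sym n⊓m≡n) (≤-trans (s≤s z≤n) N<n) , γ·q≡p·n
    where
    s a t : ℕ
    s = suc N
    a = (3 * y + z) * s
    t = (3 * y + 3 * z) * s
    a≤3t : a ≤ t * 3
    a≤3t = subst (a ≤_) (sym (eq y z s)) (m≤m+n a _)
      where eq : ∀ y z s → (3 * y + 3 * z) * s * 3 ≡ (3 * y + z) * s + (6 * y + 8 * z) * s
            eq = solve-∀
    t≤3a : t ≤ a * 3
    t≤3a = subst (t ≤_) (sym (eq y z s)) (m≤m+n t _)
      where eq : ∀ y z s → (3 * y + z) * s * 3 ≡ (3 * y + 3 * z) * s + 6 * y * s
            eq = solve-∀
    n≤m : a * 3 + t ≤ t * 3 + a
    n≤m = subst (a * 3 + t ≤_) (sym (eq y z s)) (m≤m+n (a * 3 + t) _)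
      where eq : ∀ y z s → (3 * y + 3 * z) * s * 3 + (3 * y + z) * s ≡ (3 * y + z) * s * 3 + (3 * y + 3 * z) * s + 4 * z * s
            eq = solve-∀
    n≡ : a * 3 + t ≡ 6 * (2 * y + z) * s
    n≡ = eq y z s
      where eq : ∀ y z s → (3 * y + z) * s * 3 + (3 * y + 3 * z) * s ≡ 6 * (2 * y + z) * s
            eq = solve-∀
    γ≡ : a * 3 + t * 3 ≡ 6 * (3 * y + 2 * z) * s
    γ≡ = eq y z s
      where eq : ∀ y z s → (3 * y + z) * s * 3 + (3 * y + 3 * z) * s * 3 ≡ 6 * (3 * y + 2 * z) * s
            eq = solve-∀
    n⊓m≡n : (a * 3 + t) ⊓ (t * 3 + a) ≡ a * 3 + t
    n⊓m≡n = m≤n⇒m⊓n≡m n≤m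
    γ·q≡p·n : (a * 3 + t * 3) * (2 * y + z) ≡ (3 * y + 2 * z) * ((a * 3 + t) ⊓ (t * 3 + a))
    γ·q≡p·n = begin
      (a * 3 + t * 3) * (2 * y + z)          ≡⟨ cong (_* (2 * y + z)) γ≡ ⟩
      6 * (3 * y + 2 * z) * s * (2 * y + z)  ≡⟨ eq y z s ⟩
      (3 * y + 2 * z) * (6 * (2 * y + z) * s) ≡⟨ cong ((3 * y + 2 * z) *_) (trans n⊓m≡n n≡) ⟨
      (3 * y + 2 * z) * ((a * 3 + t) ⊓ (t * 3 + a)) ∎
      where
      open ≡-Reasoning
      eq : ∀ y z s → 6 * (3 * y + 2 * z) * s * (2 * y + z) ≡ (3 * y + 2 * z) * (6 * (2 * y + z) * s)
      eq = solve-∀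
    N<n : N < a * 3 + t
    N<n = subst (N <_) (sym n≡) (m≤n*m s (6 * (2 * y + z)) {{ℕ.>-nonZero (≤-trans (s≤s z≤n) (*-monoʳ-≤ 6 q>0))}})

module Limits where

  open Combinatorics
  open import Data.Integer using (+_; -[1+_])
  import Data.Integer.Base as ℤ
  import Data.Integer.Properties as ℤ
  open import Data.Nat as ℕ using (ℕ; zero; suc)
  import Data.Nat.Properties as ℕ
  open import Data.Product using (_×_; _,_; proj₁; proj₂; Σ; ∃-syntax)
  open import Data.Rational
  open import Data.Rational.Properties
  open import Data.Rational.Solver using (module +-*-Solver)
  import Data.Rational.Unnormalised as ℚᵘ
  import Data.Rational.Unnormalised.Properties as ℚᵘ
  open import Data.Sum using (inj₁; inj₂)
  open import Relation.Binary.PropositionalEquality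

  fraction-≤ : ∀ a b c d → a ℕ.* suc d ℕ.≤ c ℕ.* suc b → (+ a) / suc b ≤ (+ c) / suc d
  fraction-≤ a b c d h =
    toℚᵘ-cancel-≤ (ℚᵘ.≤-respˡ-≃ (ℚᵘ.≃-sym (toℚᵘ-fromℚᵘ (ℚᵘ.mkℚᵘ (+ a) b)))
                  (ℚᵘ.≤-respʳ-≃ (ℚᵘ.≃-sym (toℚᵘ-fromℚᵘ (ℚᵘ.mkℚᵘ (+ c) d)))
                    (ℚᵘ.*≤* (subst₂ ℤ._≤_ (ℤ.pos-* a (suc d)) (ℤ.pos-* c (suc b)) (ℤ.+≤+ h)))))

  fraction-≤⁻ : ∀ a b c d → (+ a) / suc b ≤ (+ c) / suc d → a ℕ.* suc d ℕ.≤ c ℕ.* suc b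
  fraction-≤⁻ a b c d h
    with ℚᵘ.*≤* h′ ← ℚᵘ.≤-respˡ-≃ (toℚᵘ-fromℚᵘ (ℚᵘ.mkℚᵘ (+ a) b))
                     (ℚᵘ.≤-respʳ-≃ (toℚᵘ-fromℚᵘ (ℚᵘ.mkℚᵘ (+ c) d)) (toℚᵘ-mono-≤ h))
    = ℤ.drop‿+≤+ (subst₂ ℤ._≤_ (sym (ℤ.pos-* a (suc d))) (sym (ℤ.pos-* c (suc b))) h′)

  fraction-≡ : ∀ a b c d → a ℕ.* suc d ≡ c ℕ.* suc b → (+ a) / suc b ≡ (+ c) / suc d
  fraction-≡ a b c d h = fromℚᵘ-cong {ℚᵘ.mkℚᵘ (+ a) b} {ℚᵘ.mkℚᵘ (+ c) d}
    (ℚᵘ.*≡* (trans (sym (ℤ.pos-* a (suc d))) (trans (cong +_ h) (ℤ.pos-* c (suc b)))))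

  ratio≡fraction : ∀ γ k p d → 0 ℕ.< k → γ ℕ.* suc d ≡ p ℕ.* k → ratio γ k ≡ (+ p) / suc d
  ratio≡fraction γ (suc k) p d _ eq = fraction-≡ γ k p d eq

  3/2≤ρ : ∀ {n m γ} → 0 ℕ.< n → 0 ℕ.< m → IsGamma2t n m γ → (+ 3) / 2 ≤ ρ n m γ
  3/2≤ρ {suc n} {suc m} _ _ ((S , dom , refl) , _) =
    fraction-≤ 3 1 (card S) (n ℕ.⊓ m)
      (subst (3 ℕ.* suc (n ℕ.⊓ m) ℕ.≤_) (ℕ.*-comm 2 (card S)) (total2Dom⇒3min≤2card dom))

  ρ≤2 : ∀ {n m γ} → 2 ℕ.≤ n → 2 ℕ.≤ m → IsGamma2t n m γ → ρ n m γ ≤ (+ 2) / 1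
  ρ≤2 {suc n} {suc m} {γ} 2≤n 2≤m isγ =
    fraction-≤ γ (n ℕ.⊓ m) 2 0
      (subst (ℕ._≤ 2 ℕ.* suc (n ℕ.⊓ m)) (sym (ℕ.*-identityʳ γ)) (gamma2t≤2min 2≤n 2≤m isγ))

  3/2≤2 : (+ 3) / 2 ≤ (+ 2) / 1
  3/2≤2 = fraction-≤ 3 1 2 0 (ℕ.n≤1+n 3)

  RatioAttainedBeyond : ℕ → ℚ → Set
  RatioAttainedBeyond N r = ∃[ n ] ∃[ m ] ∃[ γ ] (N ℕ.< n × N ℕ.< m × IsGamma2t n m γ × ρ n m γ ≡ r)

  realise-fraction : ∀ p d → (+ 3) / 2 ≤ (+ p) / suc d → (+ p) / suc d ≤ (+ 2) / 1 → ∀ N →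
                     RatioAttainedBeyond N ((+ p) / suc d)
  realise-fraction p d lo hi N =
    let y , z , p≡ , q≡ = fraction-decomposition p (suc d) (fraction-≤⁻ 3 1 p d lo)
                            (subst (ℕ._≤ 2 ℕ.* suc d) (ℕ.*-identityʳ p) (fraction-≤⁻ p d 2 0 hi))
        n , m , γ , N<n , N<m , isγ , pos , γ·q≡p·n = family-attains y z N (subst (0 ℕ.<_) q≡ (ℕ.s≤s ℕ.z≤n))
    in n , m , γ , N<n , N<m , isγ ,
       ratio≡fraction γ (n ℕ.⊓ m) p d pos
         (subst₂ (λ q p → γ ℕ.* q ≡ p ℕ.* (n ℕ.⊓ m)) (sym q≡) (sym p≡) γ·q≡p·n)

  realise : ∀ r → (+ 3) / 2 ≤ r → r ≤ (+ 2) / 1 → ∀ N → RatioAttainedBeyond N r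
  realise (mkℚ -[1+ p ] d _) lo hi N with drop-*≤* lo
  ... | ()
  realise r@(mkℚ (+ p) d _) lo hi N =
    subst (RatioAttainedBeyond N) r≡
      (realise-fraction p d (subst ((+ 3) / 2 ≤_) (sym r≡) lo) (subst (_≤ (+ 2) / 1) (sym r≡) hi) N)
    where
    r≡ : (+ p) / suc d ≡ r
    r≡ = ↥p/↧p≡p r

  0≤eps : ∀ j → 0ℚ ≤ eps j
  0≤eps j = fraction-≤ 0 0 1 j ℕ.z≤n

  eps-antitone : ∀ {j k} → j ℕ.≤ k → eps k ≤ eps j
  eps-antitone {j} {k} j≤k = fraction-≤ 1 k 1 j (ℕ.*-monoʳ-≤ 1 (ℕ.s≤s j≤k))

  p-q≤p : ∀ p {q} → 0ℚ ≤ q → p - q ≤ p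
  p-q≤p p 0≤q = ≤-trans (+-monoʳ-≤ p (neg-antimono-≤ 0≤q)) (≤-reflexive (+-identityʳ p))

  p≤p+q : ∀ p {q} → 0ℚ ≤ q → p ≤ p + q
  p≤p+q p 0≤q = ≤-trans (≤-reflexive (sym (+-identityʳ p))) (+-monoʳ-≤ p 0≤q)

  p≤q+p : ∀ p {q} → 0ℚ ≤ q → p ≤ q + p
  p≤q+p p {q} 0≤q = ≤-trans (p≤p+q p 0≤q) (≤-reflexive (+-comm p q))

  p≤∣p∣ : ∀ p → p ≤ ∣ p ∣
  p≤∣p∣ p with ∣p∣≡p∨∣p∣≡-p p
  ... | inj₁ e = ≤-reflexive (sym e)
  ... | inj₂ e = ≤-trans p≤0 (0≤∣p∣ p)
    where
    p≤0 : p ≤ 0ℚ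
    p≤0 = ≤-trans (≤-reflexive (sym (+-identityʳ p)))
            (≤-trans (+-monoʳ-≤ p (subst (0ℚ ≤_) e (0≤∣p∣ p))) (≤-reflexive (+-inverseʳ p)))

  neg-sub : ∀ p q → - (p - q) ≡ q - p
  neg-sub = solve 2 (λ p q → :- (p :- q) := q :- p) refl
    where open +-*-Solver

  ∣p-q∣≤ : ∀ {p q B} → p - q ≤ B → q - p ≤ B → ∣ p - q ∣ ≤ B
  ∣p-q∣≤ {p} {q} h₁ h₂ with ∣p∣≡p∨∣p∣≡-p (p - q)
  ... | inj₁ e = subst (_≤ _) (sym e) h₁
  ... | inj₂ e = subst (_≤ _) (sym (trans e (neg-sub p q))) h₂

  ∣p-q∣≤⁻ : ∀ {p q B} → ∣ p - q ∣ ≤ B → p - q ≤ B × q - p ≤ B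
  ∣p-q∣≤⁻ {p} {q} h = ≤-trans (p≤∣p∣ (p - q)) h ,
    ≤-trans (subst₂ _≤_ (neg-sub p q) (∣-p∣≡∣p∣ (p - q)) (p≤∣p∣ (- (p - q)))) h

  p-B≤q⇒p-q≤B : ∀ {p q B} → p - B ≤ q → p - q ≤ B
  p-B≤q⇒p-q≤B {p} {q} {B} h = subst₂ _≤_ (e₁ p q B) (e₂ q B) (+-monoˡ-≤ (B - q) h)
    where
    open +-*-Solver
    e₁ : ∀ p q B → p - B + (B - q) ≡ p - q
    e₁ = solve 3 (λ p q B → p :- B :+ (B :- q) := p :- q) refl
    e₂ : ∀ q B → q + (B - q) ≡ B
    e₂ = solve 2 (λ q B → q :+ (B :- q) := B) refl

  q≤p+B⇒q-p≤B : ∀ {p q B} → q ≤ p + B → q - p ≤ B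
  q≤p+B⇒q-p≤B {p} {q} {B} h = ≤-trans (+-monoˡ-≤ (- p) h) (≤-reflexive (e p B))
    where
    open +-*-Solver
    e : ∀ p B → p + B - p ≡ B
    e = solve 2 (λ p B → p :+ B :- p := B) refl

  clamp : ℚ → ℚ → ℚ → ℚ
  clamp lo hi x = lo ⊔ (x ⊓ hi)

  clamp-≥ : ∀ lo hi x → lo ≤ clamp lo hi x
  clamp-≥ lo hi x = p≤p⊔q lo (x ⊓ hi)

  clamp-≤ : ∀ {lo hi} x → lo ≤ hi → clamp lo hi x ≤ hi
  clamp-≤ {lo} {hi} x lo≤hi = ⊔-lub lo≤hi (p⊓q≤q x hi)

  clamp-distance : ∀ {lo hi B} x y → lo ≤ hi → ∣ x - y ∣ ≤ B → lo - B ≤ y → y ≤ hi + B →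
                   ∣ clamp lo hi x - y ∣ ≤ B
  clamp-distance {lo} {hi} {B} x y lo≤hi d lo-B≤y y≤hi+B with ≤-total x hi
  ... | inj₂ hi≤x = subst (λ c → ∣ c - y ∣ ≤ B)
    (sym (trans (cong (lo ⊔_) (p≥q⇒p⊓q≡q hi≤x)) (p≤q⇒p⊔q≡q lo≤hi)))
    (∣p-q∣≤ {hi} {y} (≤-trans (+-monoˡ-≤ (- y) hi≤x) (proj₁ (∣p-q∣≤⁻ {x} {y} d)))
                     (q≤p+B⇒q-p≤B {hi} {y} y≤hi+B))
  ... | inj₁ x≤hi with ≤-total x lo
  ...   | inj₁ x≤lo = subst (λ c → ∣ c - y ∣ ≤ B)
    (sym (trans (cong (lo ⊔_) (p≤q⇒p⊓q≡p x≤hi)) (p≥q⇒p⊔q≡p x≤lo)))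
    (∣p-q∣≤ {lo} {y} (p-B≤q⇒p-q≤B {lo} {y} lo-B≤y)
                     (≤-trans (+-monoʳ-≤ y (neg-antimono-≤ x≤lo)) (proj₂ (∣p-q∣≤⁻ {x} {y} d))))
  ...   | inj₂ lo≤x = subst (λ c → ∣ c - y ∣ ≤ B)
    (sym (trans (cong (lo ⊔_) (p≤q⇒p⊓q≡p x≤hi)) (p≤q⇒p⊔q≡q lo≤x))) d

  clamp-converges : ∀ {lo hi} (α : ℝ) → lo ≤ hi → lo ≤ᵣ α → α ᵣ≤ hi →
                    ConvergesTo (λ k → clamp lo hi (seq α k)) α
  clamp-converges {lo} {hi} α lo≤hi lo≤α α≤hi j = j , λ k j≤k i →
    clamp-distance (seq α k) (seq α i) lo≤hi
      (≤-trans (reg α k i) (+-monoˡ-≤ (eps i) (eps-antitone j≤k)))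
      (≤-trans (+-monoʳ-≤ lo (neg-antimono-≤ (p≤q+p (eps i) (0≤eps j)))) (lo≤α i))
      (≤-trans (α≤hi i) (+-monoʳ-≤ hi (p≤q+p (eps i) (0≤eps j))))

  ConvergesTo-cong : ∀ {r r′ : ℕ → ℚ} {α} → (∀ k → r k ≡ r′ k) → ConvergesTo r α → ConvergesTo r′ α
  ConvergesTo-cong {α = α} r≗r′ conv j =
    let K , close = conv j in K , λ k K≤k i → subst (λ x → ∣ x - seq α i ∣ ≤ eps j + eps i) (r≗r′ k) (close k K≤k i)

  liminf : LimInfEq ((+ 3) / 2)
  liminf =
    (λ j → 1 , λ n m γ 1≤n 1≤m isγ → ≤-trans (p-q≤p _ (0≤eps j)) (3/2≤ρ 1≤n 1≤m isγ)) ,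
    λ j N → let n , m , γ , N<n , N<m , isγ , ρ≡3/2 = realise ((+ 3) / 2) ≤-refl 3/2≤2 N
            in n , m , γ , ℕ.<⇒≤ N<n , ℕ.<⇒≤ N<m , isγ , ≤-trans (≤-reflexive ρ≡3/2) (p≤p+q _ (0≤eps j))

  limsup : LimSupEq ((+ 2) / 1)
  limsup =
    (λ j → 2 , λ n m γ 2≤n 2≤m isγ → ≤-trans (ρ≤2 2≤n 2≤m isγ) (p≤p+q _ (0≤eps j))) ,
    λ j N → let n , m , γ , N<n , N<m , isγ , ρ≡2 = realise ((+ 2) / 1) 3/2≤2 ≤-refl N
            in n , m , γ , ℕ.<⇒≤ N<n , ℕ.<⇒≤ N<m , isγ , ≤-trans (p-q≤p _ (0≤eps j)) (≤-reflexive (sym ρ≡2))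

  everyLimit : (α : ℝ) → ((+ 3) / 2) ≤ᵣ α → α ᵣ≤ ((+ 2) / 1) →
    Σ (ℕ → ℕ) (λ n → Σ (ℕ → ℕ) (λ m → Σ (ℕ → ℕ) (λ g →
      ((k : ℕ) → 1 ℕ.≤ n k × 1 ℕ.≤ m k × IsGamma2t (n k) (m k) (g k)) ×
      ConvergesTo (λ k → ρ (n k) (m k) (g k)) α)))
  everyLimit α lo≤α α≤hi =
    (λ k → proj₁ (attained k)) , (λ k → proj₁ (proj₂ (attained k))) , (λ k → proj₁ (proj₂ (proj₂ (attained k)))) ,
    (λ k → let _ , _ , _ , 0<n , 0<m , isγ , _ = attained k in 0<n , 0<m , isγ) ,
    ConvergesTo-cong {α = α} (λ k → let _ , _ , _ , _ , _ , _ , ρ≡ = attained k in sym ρ≡)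
      (clamp-converges α 3/2≤2 lo≤α α≤hi)
    where
    attained : ∀ k → RatioAttainedBeyond 0 (clamp ((+ 3) / 2) ((+ 2) / 1) (seq α k))
    attained k = realise (clamp ((+ 3) / 2) ((+ 2) / 1) (seq α k))
      (clamp-≥ _ _ (seq α k)) (clamp-≤ (seq α k) 3/2≤2) 0

open import Data.Nat using (ℕ; _≤_)
open import Data.Integer using (+_)
open import Data.Rational using (ℚ; _/_)
open import Data.Product using (_×_; Σ; _,_)

theorem2p19 : LimInfEq ((+ 3) / 2) × LimSupEq ((+ 2) / 1) ×
    ((α : ℝ) → ((+ 3) / 2) ≤ᵣ α → α ᵣ≤ ((+ 2) / 1) →
      Σ (ℕ → ℕ) (λ n → Σ (ℕ → ℕ) (λ m → Σ (ℕ → ℕ) (λ g →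
        ((k : ℕ) → 1 ≤ n k × 1 ≤ m k × IsGamma2t (n k) (m k) (g k)) ×
        ConvergesTo (λ k → ρ (n k) (m k) (g k)) α))))
theorem2p19 = liminf , limsup , everyLimit
  where open Limits
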